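{- Let $m$ be a positive integer, let $T$ be a $k$-tubing and $T'$ a $(k+j)$-tubing of the star graph $K_{1,m}$, and let $C=C(T)$ and $C'=C(T')$ be their associated chains in $\mathcal{B}_m$. Then $T\subset T'$ if and only if $C'$ can be obtained from $C$ by $j$ iterations of the following operations: (1) adding a non-maximal subset to the chain; (2) removing the same element from every subset of the chain.
   Context: $K_{1,m}$ has an inner vertex $*$ adjacent to outer vertices $x_1,\ldots,x_m$ and no other edges. A tube is a nonempty proper vertex subset inducing a connected subgraph. Two tubes are compatible if one contains the other, or if they are disjoint and their union does not induce a connected subgraph. A tubing is a set of pairwise compatible tubes; a $k$-tubing is a tubing with $k$ tubes. $\mathcal{B}_m$ is the lattice of subsets of $[m]$; chains are nonempty sets of subsets totally ordered by inclusion. The chain of a tubing $T$: let $I=\{i:\{x_i\}\in T\}$, let $\tau_1\subsetneq\cdots\subsetneq\tau_{t-1}$ be the tubes of $T$ containing $*$ (they are nested), and let $\tau_t$ be the whole vertex set; then $C(T)$ is the chain $C_1\subsetneq\cdots\subsetneq C_t$ with $C_s=\{i:x_i\in\tau_s\}\setminus I$. (This is a bijection from tubings to chains.) A "non-maximal subset" added in (1) is a subset properly contained in the largest subset of the chain. -}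

module Defs where

open import Data.Nat using (ℕ; zero; suc; _+_)
open import Data.Bool using (Bool)
import Data.Bool.Properties as BoolP
open import Data.Fin using (Fin)
import Data.Fin as Fin
open import Data.Fin.Subset using (Subset; ⁅_⁆; _∈_; _∉_; _⊆_; _⊂_; _∩_; _∪_; _─_; _-_; ⊤; Empty; Nonempty)
import Data.Fin.Subset.Properties
open import Data.Vec using (tail; tabulate)
open import Data.Vec.Properties using (≡-dec)
open import Data.List using (List; []; _∷_; map; filter; _++_; length)
import Data.List.Membership.Propositional as LMem
open import Data.List.Relation.Unary.Unique.Propositional using (Unique)
open import Data.List.Relation.Unary.Any using (any?)
open import Data.Product using (_×_; ∃; Σ; _,_)
open import Data.Sum using (_⊎_)
open import Relation.Binary.PropositionalEquality using (_≡_; _≢_)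
open import Relation.Nullary using (¬_; does)
open import Function.Bundles using (_⇔_)

-- The star graph K_{1,m}.
-- Vertex set: Fin (suc m).  Vertex  Fin.zero  is the inner vertex  * ,
-- vertex  Fin.suc i  is the outer vertex  x_i  (i : Fin m).

Vertex : ℕ → Set
Vertex m = Fin (suc m)

star : ∀ {m} → Vertex m
star = Fin.zero

outer : ∀ {m} → Fin m → Vertex m
outer = Fin.suc

data Adj {m : ℕ} : Vertex m → Vertex m → Set where
  in→out : ∀ i → Adj star (outer i)
  out→in : ∀ i → Adj (outer i) star

data WalkIn {m : ℕ} (S : Subset (suc m)) : Vertex m → Vertex m → Set where
  here : ∀ {u} → u ∈ S → WalkIn S u u
  step : ∀ {u v w} → u ∈ S → Adj u v → WalkIn S v w → WalkIn S u w

InducesConnected : ∀ {m} → Subset (suc m) → Set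
InducesConnected {m} S = ∀ (u v : Vertex m) → u ∈ S → v ∈ S → WalkIn S u v

IsTube : ∀ {m} → Subset (suc m) → Set
IsTube S = Nonempty S × S ⊂ ⊤ × InducesConnected S

Compatible : ∀ {m} → Subset (suc m) → Subset (suc m) → Set
Compatible A B =
  A ⊆ B ⊎ B ⊆ A ⊎ (Empty (A ∩ B) × ¬ InducesConnected (A ∪ B))

-- a tubing (a finite set of tubes, represented by a duplicate-free list)
IsTubing : ∀ {m} → List (Subset (suc m)) → Set
IsTubing T =
  Unique T
  × (∀ {A} → A LMem.∈ T → IsTube A)
  × (∀ {A B} → A LMem.∈ T → B LMem.∈ T → Compatible A B)

IsKTubing : ∀ {m} → ℕ → List (Subset (suc m)) → Set
IsKTubing k T = IsTubing T × length T ≡ k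

_⊆T_ : ∀ {m} → List (Subset (suc m)) → List (Subset (suc m)) → Set
T ⊆T T' = ∀ {A} → A LMem.∈ T → A LMem.∈ T'

-- The chain C(T) of a tubing, as a list of subsets of [m]
-- (a chain is a set; the list represents its set of elements).

outerPart : ∀ {m} → Subset (suc m) → Subset m
outerPart = tail

-- I = { i : {x_i} ∈ T }
singletonIdx : ∀ {m} → List (Subset (suc m)) → Subset m
singletonIdx T = tabulate (λ i → does (any? (≡-dec BoolP._≟_ ⁅ outer i ⁆) T))

chainOf : ∀ {m} → List (Subset (suc m)) → List (Subset m)
chainOf T =
  map (λ τ → outerPart τ ─ singletonIdx T)
      (filter (λ τ → Data.Fin.Subset.Properties._∈?_ star τ) T ++ ⊤ ∷ [])

_∈C_ : ∀ {m} → Subset m → List (Subset m) → Set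
X ∈C C = X LMem.∈ C

_≈C_ : ∀ {m} → List (Subset m) → List (Subset m) → Set
C ≈C D = ∀ X → (X ∈C C) ⇔ (X ∈C D)

IsChain : ∀ {m} → List (Subset m) → Set
IsChain C = Σ _ (λ X → X ∈C C)
          × (∀ {X Y} → X ∈C C → Y ∈C C → X ⊆ Y ⊎ Y ⊆ X)

IsLargest : ∀ {m} → Subset m → List (Subset m) → Set
IsLargest M C = M ∈C C × (∀ {X} → X ∈C C → X ⊆ M)

AddNonMaximal : ∀ {m} → List (Subset m) → List (Subset m) → Set
AddNonMaximal C D =
  ∃ λ S → ∃ λ M →
    IsLargest M C × S ⊂ M × ¬ (S ∈C C)
    × IsChain (S ∷ C) × D ≈C (S ∷ C)

RemoveElement : ∀ {m} → List (Subset m) → List (Subset m) → Set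
RemoveElement C D =
  ∃ λ i → (∀ {X} → X ∈C C → i ∈ X) × D ≈C map (λ X → X - i) C

ChainStep : ∀ {m} → List (Subset m) → List (Subset m) → Set
ChainStep C D = AddNonMaximal C D ⊎ RemoveElement C D

data Iterates {m : ℕ} : ℕ → List (Subset m) → List (Subset m) → Set where
  done : ∀ {C D} → C ≈C D → Iterates zero C D
  more : ∀ {j C D E} → ChainStep C D → Iterates j D E → Iterates (suc j) C E

-- A tube of K_{1,m} either contains the inner vertex, and then it is any proper vertex set
-- containing it, or it is a singleton {x_i}. Tubes through the inner vertex are nested and contain
-- every singleton tube, so C(T) determines T. Adding a tube through the inner vertex adds its outer
-- part (minus I) to the chain, strictly below the top element; adding a singleton {x_i} enlarges I,
-- i.e. removes i from every member. Conversely operation (1) with the subset S is realised by the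
-- tube {*} ∪ S ∪ I, and operation (2) with the element i by the tube {x_i}. Finally, a k-tubing
-- inside a (k+j)-tubing is reached by adding its j missing tubes one at a time.
module Submission where

open import Defs
open import Data.Bool.Properties using () renaming (_≟_ to _≟ᵇ_)
open import Data.Empty using (⊥-elim)
open import Data.Fin using (Fin; zero; suc)
open import Data.Fin.Properties using (suc-injective) renaming (_≟_ to _≟ᶠ_)
open import Data.Fin.Subset
  using (Subset; inside; outside; ⁅_⁆; _∈_; _∉_; _⊆_; _⊂_; _∩_; _∪_; _─_; _-_; ⊤; Empty; Nonempty)
open import Data.Fin.Subset.Properties
  using ( _∈?_; ∈⊤; ⊆⊤; x∈⁅x⁆; x∈⁅y⁆⇒x≡y; x≢y⇒x∉⁅y⁆; ⊆-antisym; ⊂-irref; drop-there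
        ; x∈p∪q⁺; x∈p∪q⁻; x∈p∩q⁺; x∈p∩q⁻; ∩-comm; ∪-comm
        ; x∈p∧x∉q⇒x∈p─q; p─q⊆p; p─q─r≡p─q∪r)
open import Data.List using (List; []; _∷_; map; filter; _++_; length)
open import Data.List.Properties
  using (filter-accept; filter-reject; map-cong; map-∘; length-removeAt′)
open import Data.List.Membership.Propositional
  using (find; lose) renaming (_∈_ to _∈ₗ_; _∉_ to _∉ₗ_)
open import Data.List.Membership.Propositional.Properties
  using (∈-map⁺; ∈-map⁻; ∈-++⁺ˡ; ∈-++⁺ʳ; ∈-++⁻; ∈-filter⁺; ∈-filter⁻)
import Data.List.Membership.DecPropositional as DecMembership
open import Data.List.Relation.Binary.BagAndSetEquality
  using (∷-cong) renaming (map-cong to map-∼-cong)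
open import Data.List.Relation.Binary.Subset.Propositional using () renaming (_⊆_ to _⊆ₗ_)
open import Data.List.Relation.Unary.All as All using ()
open import Data.List.Relation.Unary.All.Properties using (¬Any⇒All¬)
open import Data.List.Relation.Unary.AllPairs using (_∷_)
open import Data.List.Relation.Unary.Any as Any using (here; there; any?)
open import Data.List.Relation.Unary.Unique.Propositional using (Unique)
open import Data.Nat using (ℕ; zero; suc; _+_; _≤_; _<_; s≤s; z≤n)
open import Data.Nat.Properties using (<-irrefl; m+1+n≰m; +-identityʳ; +-suc; module ≤-Reasoning)
open import Data.Product using (∃; _×_; _,_; proj₁; proj₂)
open import Data.Sum using (_⊎_; inj₁; inj₂)
open import Data.Vec using (_∷_; here; there)
open import Data.Vec.Properties using (≡-dec; lookup∘tabulate; []=⇒lookup; lookup⇒[]=)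
open import Function using (_∘_)
open import Function.Bundles using (_⇔_; mk⇔; Equivalence)
open import Function.Construct.Identity using (⇔-id)
open import Function.Construct.Symmetry using (⇔-sym)
open import Function.Construct.Composition using (_⇔-∘_)
open import Relation.Binary.Definitions using (DecidableEquality)
open import Relation.Binary.PropositionalEquality
  using (_≡_; _≢_; refl; sym; trans; cong; subst; module ≡-Reasoning)
open import Relation.Nullary using (¬_; Dec; yes; no; does; ¬?)
open import Relation.Nullary.Decidable using (dec-true; decidable-stable)

private
  variable
    m n : ℕ
    i j : Fin m
    p q r : Subset n
    A B σ ρ τ : Subset (suc m)
    T U V : List (Subset (suc m))
    C D E : List (Subset m)

x∈p─q⇒x∉q : ∀ (p q : Subset n) {x} → x ∈ p ─ q → x ∉ q
x∈p─q⇒x∉q (inside ∷ p) (outside ∷ q) here = λ ()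
x∈p─q⇒x∉q (_ ∷ p) (_ ∷ q) (there x∈p─q) (there x∈q) = x∈p─q⇒x∉q p q x∈p─q x∈q

─-monoˡ-⊆ : p ⊆ q → p ─ r ⊆ q ─ r
─-monoˡ-⊆ {p = p} {r = r} p⊆q x∈p─r =
  x∈p∧x∉q⇒x∈p─q (p⊆q (p─q⊆p p r x∈p─r)) (x∈p─q⇒x∉q p r x∈p─r)

─-cancelʳ : r ⊆ p → r ⊆ q → p ─ r ≡ q ─ r → p ≡ q
─-cancelʳ r⊆p r⊆q eq = ⊆-antisym (⊆-by r⊆q eq) (⊆-by r⊆p (sym eq))
  where
  ⊆-by : ∀ {p q r : Subset n} → r ⊆ q → p ─ r ≡ q ─ r → p ⊆ q
  ⊆-by {p = p} {q} {r} r⊆q eq {x} x∈p with x ∈? r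
  ... | yes x∈r = r⊆q x∈r
  ... | no x∉r = p─q⊆p q r (subst (x ∈_) eq (x∈p∧x∉q⇒x∈p─q x∈p x∉r))

⊤─-injective : ⊤ ─ p ≡ ⊤ ─ q → p ≡ q
⊤─-injective eq = ⊆-antisym (⊆-by eq) (⊆-by (sym eq))
  where
  ⊆-by : ∀ {p q : Subset n} → ⊤ ─ p ≡ ⊤ ─ q → p ⊆ q
  ⊆-by {p = p} {q} eq {x} x∈p with x ∈? q
  ... | yes x∈q = x∈q
  ... | no x∉q =
    ⊥-elim (x∈p─q⇒x∉q ⊤ p (subst (x ∈_) (sym eq) (x∈p∧x∉q⇒x∈p─q ∈⊤ x∉q)) x∈p)

p∪q─q≡p : (∀ {x} → x ∈ p → x ∉ q) → (p ∪ q) ─ q ≡ p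
p∪q─q≡p {p = p} {q} p∩q≡∅ = ⊆-antisym ⊆p p⊆
  where
  ⊆p : (p ∪ q) ─ q ⊆ p
  ⊆p x∈ with x∈p∪q⁻ p q (p─q⊆p (p ∪ q) q x∈)
  ... | inj₁ x∈p = x∈p
  ... | inj₂ x∈q = ⊥-elim (x∈p─q⇒x∉q (p ∪ q) q x∈ x∈q)
  p⊆ : p ⊆ (p ∪ q) ─ q
  p⊆ x∈p = x∈p∧x∉q⇒x∈p─q (x∈p∪q⁺ (inj₁ x∈p)) (p∩q≡∅ x∈p)

⁅x⁆⊆ : ∀ {x : Fin n} → x ∈ p → ⁅ x ⁆ ⊆ p
⁅x⁆⊆ {x = x} x∈p y∈ with x∈⁅y⁆⇒x≡y x y∈
... | refl = x∈p

-- Tubes of the star graph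

outer∈⇒∈outerPart : outer i ∈ σ → i ∈ outerPart σ
outer∈⇒∈outerPart {σ = _ ∷ _} = drop-there

∈outerPart⇒outer∈ : i ∈ outerPart σ → outer i ∈ σ
∈outerPart⇒outer∈ {σ = _ ∷ _} = there

outerPart-mono : A ⊆ B → outerPart A ⊆ outerPart B
outerPart-mono {A = _ ∷ _} {_ ∷ _} A⊆B = drop-there ∘ A⊆B ∘ there

star∈⇒≡ : star ∈ σ → star ∈ ρ → outerPart σ ≡ outerPart ρ → σ ≡ ρ
star∈⇒≡ {σ = _ ∷ _} {_ ∷ _} here here refl = refl

inside∷-⊆ : star ∈ σ → p ⊆ outerPart σ → inside ∷ p ⊆ σ
inside∷-⊆ {σ = _ ∷ _} star∈σ p⊆ here = star∈σ
inside∷-⊆ {σ = _ ∷ _} star∈σ p⊆ (there x∈p) = there (p⊆ x∈p)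

⊆-inside∷ : outerPart σ ⊆ p → σ ⊆ inside ∷ p
⊆-inside∷ {σ = _ ∷ _} σ⊆ here = here
⊆-inside∷ {σ = _ ∷ _} σ⊆ (there x∈σ) = there (σ⊆ x∈σ)

star∉⁅outer⁆ : star ∉ ⁅ outer i ⁆
star∉⁅outer⁆ {i = i} = x≢y⇒x∉⁅y⁆ {y = outer i} λ ()

⁅outer⁆-injective : ⁅ outer i ⁆ ≡ ⁅ outer j ⁆ → i ≡ j
⁅outer⁆-injective {i = i} {j = j} eq =
  suc-injective (x∈⁅y⁆⇒x≡y (outer j) (subst (outer i ∈_) eq (x∈⁅x⁆ (outer i))))

walkIn-source : ∀ {u v : Vertex m} → WalkIn A u v → u ∈ A
walkIn-source (here u∈A) = u∈A
walkIn-source (step u∈A _ _) = u∈A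

star∈⇒connected : star ∈ A → InducesConnected A
star∈⇒connected star∈A zero zero _ _ = here star∈A
star∈⇒connected star∈A zero (suc j) _ v∈A = step star∈A (in→out j) (here v∈A)
star∈⇒connected star∈A (suc i) zero u∈A _ = step u∈A (out→in i) (here star∈A)
star∈⇒connected star∈A (suc i) (suc j) u∈A v∈A =
  step u∈A (out→in i) (step star∈A (in→out j) (here v∈A))

inside∷-isTube : i ∉ p → IsTube (inside ∷ p)
inside∷-isTube {i = i} i∉p =
  (star , here) , (⊆⊤ , outer i , ∈⊤ , i∉p ∘ drop-there) , star∈⇒connected here

⁅outer⁆-isTube : (i : Fin m) → IsTube ⁅ outer i ⁆
⁅outer⁆-isTube i = (outer i , x∈⁅x⁆ _) , (⊆⊤ , star , ∈⊤ , star∉⁅outer⁆) , connected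
  where
  connected : InducesConnected ⁅ outer i ⁆
  connected u v u∈ v∈ with x∈⁅y⁆⇒x≡y (outer i) u∈ | x∈⁅y⁆⇒x≡y (outer i) v∈
  ... | refl | refl = here u∈

tube-star-or-singleton : IsTube σ → star ∈ σ ⊎ ∃ λ i → σ ≡ ⁅ outer i ⁆
tube-star-or-singleton {σ = σ} ((zero , star∈σ) , _) = inj₁ star∈σ
tube-star-or-singleton {σ = σ} ((suc i , x∈σ) , _ , connected) with star ∈? σ
... | yes star∈σ = inj₁ star∈σ
... | no star∉σ = inj₂ (i , ⊆-antisym σ⊆ (⁅x⁆⊆ x∈σ))
  where
  σ⊆ : σ ⊆ ⁅ outer i ⁆
  σ⊆ {y} y∈σ with connected (outer i) y x∈σ y∈σ
  ... | here _ = x∈⁅x⁆ _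
  ... | step _ (out→in _) walk = ⊥-elim (star∉σ (walkIn-source walk))

compatible-sym : Compatible A B → Compatible B A
compatible-sym (inj₁ A⊆B) = inj₂ (inj₁ A⊆B)
compatible-sym (inj₂ (inj₁ B⊆A)) = inj₁ B⊆A
compatible-sym {A = A} {B} (inj₂ (inj₂ (disjoint , disconnected))) =
  inj₂ (inj₂ ( disjoint ∘ subst Nonempty (∩-comm B A)
             , disconnected ∘ subst InducesConnected (∪-comm B A)))

⁅outer⁆-compatible : (i j : Fin m) → Compatible ⁅ outer i ⁆ ⁅ outer j ⁆
⁅outer⁆-compatible i j with i ≟ᶠ j
... | yes refl = inj₁ (λ x∈ → x∈)
... | no i≢j = inj₂ (inj₂ (disjoint , disconnected))
  where
  disjoint : Empty (⁅ outer i ⁆ ∩ ⁅ outer j ⁆)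
  disjoint (x , x∈) with x∈p∩q⁻ ⁅ outer i ⁆ ⁅ outer j ⁆ x∈
  ... | x∈⁅i⁆ , x∈⁅j⁆ = i≢j (suc-injective (trans (sym (x∈⁅y⁆⇒x≡y _ x∈⁅i⁆)) (x∈⁅y⁆⇒x≡y _ x∈⁅j⁆)))
  disconnected : ¬ InducesConnected (⁅ outer i ⁆ ∪ ⁅ outer j ⁆)
  disconnected connected
    with connected (outer i) (outer j) (x∈p∪q⁺ (inj₁ (x∈⁅x⁆ _))) (x∈p∪q⁺ (inj₂ (x∈⁅x⁆ _)))
  ... | here _ = i≢j refl
  ... | step _ (out→in _) walk with x∈p∪q⁻ ⁅ outer i ⁆ ⁅ outer j ⁆ (walkIn-source walk)
  ...   | inj₁ star∈ = star∉⁅outer⁆ star∈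
  ...   | inj₂ star∈ = star∉⁅outer⁆ star∈

compatible-star⇒nested : star ∈ A → star ∈ B → Compatible A B → A ⊆ B ⊎ B ⊆ A
compatible-star⇒nested _ _ (inj₁ A⊆B) = inj₁ A⊆B
compatible-star⇒nested _ _ (inj₂ (inj₁ B⊆A)) = inj₂ B⊆A
compatible-star⇒nested star∈A star∈B (inj₂ (inj₂ (disjoint , _))) =
  ⊥-elim (disjoint (star , x∈p∩q⁺ (star∈A , star∈B)))

compatible-star⇒∋outer : star ∈ σ → Compatible ⁅ outer i ⁆ σ → outer i ∈ σ
compatible-star⇒∋outer _ (inj₁ ⊆σ) = ⊆σ (x∈⁅x⁆ _)
compatible-star⇒∋outer star∈σ (inj₂ (inj₁ σ⊆)) = ⊥-elim (star∉⁅outer⁆ (σ⊆ star∈σ))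
compatible-star⇒∋outer star∈σ (inj₂ (inj₂ (_ , disconnected))) =
  ⊥-elim (disconnected (star∈⇒connected (x∈p∪q⁺ (inj₂ star∈σ))))

tubing⇒unique : IsTubing T → Unique T
tubing⇒unique (unique , _ , _) = unique

tubing⇒tube : IsTubing T → σ ∈ₗ T → IsTube σ
tubing⇒tube (_ , tubes , _) = tubes

tubing⇒compatible : IsTubing T → σ ∈ₗ T → ρ ∈ₗ T → Compatible σ ρ
tubing⇒compatible (_ , _ , compatible) = compatible

tubing-tail : IsTubing (τ ∷ T) → IsTubing T
tubing-tail (_ ∷ unique , tubes , compatible) =
  unique , tubes ∘ there , λ σ∈ ρ∈ → compatible (there σ∈) (there ρ∈)

tubing-∷ : IsTubing T → τ ∉ₗ T → IsTube τ → (∀ {σ} → σ ∈ₗ T → Compatible τ σ) →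
  IsTubing (τ ∷ T)
tubing-∷ {T = T} {τ} (unique , tubes , compatible) τ∉T τ-tube τ-compatible =
  ¬Any⇒All¬ T τ∉T ∷ unique , tubes′ , compatible′
  where
  tubes′ : ∀ {σ} → σ ∈ₗ τ ∷ T → IsTube σ
  tubes′ (here refl) = τ-tube
  tubes′ (there σ∈T) = tubes σ∈T
  compatible′ : ∀ {σ ρ} → σ ∈ₗ τ ∷ T → ρ ∈ₗ τ ∷ T → Compatible σ ρ
  compatible′ (here refl) (here refl) = inj₁ (λ x∈ → x∈)
  compatible′ (here refl) (there ρ∈T) = τ-compatible ρ∈T
  compatible′ (there σ∈T) (here refl) = compatible-sym (τ-compatible σ∈T)
  compatible′ (there σ∈T) (there ρ∈T) = compatible σ∈T ρ∈T

-- The chain of a tubing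

starTubes : List (Subset (suc m)) → List (Subset (suc m))
starTubes = filter (star ∈?_)

-- chainOf T is chainFrom (singletonIdx T) (starTubes T) by definition.
chainFrom : Subset m → List (Subset (suc m)) → List (Subset m)
chainFrom J L = map (λ τ → outerPart τ ─ J) (L ++ ⊤ ∷ [])

∈-singletonIdx⁻ : (T : List (Subset (suc m))) → i ∈ singletonIdx T → ⁅ outer i ⁆ ∈ₗ T
∈-singletonIdx⁻ {i = i} T i∈ =
  yes⇒ (any? _ T) (trans (sym (lookup∘tabulate _ i)) ([]=⇒lookup i∈))
  where
  yes⇒ : ∀ {P : Set} (P? : Dec P) → does P? ≡ inside → P
  yes⇒ (yes p) _ = p

∈-singletonIdx⁺ : (T : List (Subset (suc m))) → ⁅ outer i ⁆ ∈ₗ T → i ∈ singletonIdx T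
∈-singletonIdx⁺ {i = i} T ⁅i⁆∈T =
  lookup⇒[]= i _ (trans (lookup∘tabulate _ i) (dec-true (any? _ T) ⁅i⁆∈T))

∈-chainOf⁺ : (T : List (Subset (suc m))) → σ ∈ₗ T → star ∈ σ →
  outerPart σ ─ singletonIdx T ∈ₗ chainOf T
∈-chainOf⁺ T σ∈T star∈σ = ∈-map⁺ _ (∈-++⁺ˡ (∈-filter⁺ (star ∈?_) σ∈T star∈σ))

top∈chainOf : (T : List (Subset (suc m))) → ⊤ ─ singletonIdx T ∈ₗ chainOf T
top∈chainOf T = ∈-map⁺ _ (∈-++⁺ʳ (starTubes T) (here refl))

∈-chainOf⁻ : ∀ {X} (T : List (Subset (suc m))) → X ∈ₗ chainOf T →
  (∃ λ σ → σ ∈ₗ T × star ∈ σ × X ≡ outerPart σ ─ singletonIdx T) ⊎ X ≡ ⊤ ─ singletonIdx T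
∈-chainOf⁻ T X∈ with ∈-map⁻ _ X∈
... | σ , σ∈ , refl with ∈-++⁻ (starTubes T) σ∈
...   | inj₁ σ∈starTubes = let σ∈T , star∈σ = ∈-filter⁻ (star ∈?_) σ∈starTubes
                           in inj₁ (σ , σ∈T , star∈σ , refl)
...   | inj₂ (here refl) = inj₂ refl

singletonIdx⊆outerPart : IsTubing T → σ ∈ₗ T → star ∈ σ → singletonIdx T ⊆ outerPart σ
singletonIdx⊆outerPart {T = T} tubing σ∈T star∈σ i∈ = outer∈⇒∈outerPart
  (compatible-star⇒∋outer star∈σ (tubing⇒compatible tubing (∈-singletonIdx⁻ T i∈) σ∈T))

chainOf-largest : (T : List (Subset (suc m))) → IsLargest (⊤ ─ singletonIdx T) (chainOf T)
chainOf-largest T = top∈chainOf T , ⊆top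
  where
  ⊆top : ∀ {X} → X ∈ₗ chainOf T → X ⊆ ⊤ ─ singletonIdx T
  ⊆top X∈ with ∈-chainOf⁻ T X∈
  ... | inj₁ (_ , _ , _ , refl) = ─-monoˡ-⊆ ⊆⊤
  ... | inj₂ refl = λ x∈ → x∈

chainOf-isChain : IsTubing T → IsChain (chainOf T)
chainOf-isChain {T = T} tubing = (_ , top∈chainOf T) , comparable
  where
  ⊆top : ∀ {X} → X ∈ₗ chainOf T → X ⊆ ⊤ ─ singletonIdx T
  ⊆top = proj₂ (chainOf-largest T)
  comparable : ∀ {X Y} → X ∈ₗ chainOf T → Y ∈ₗ chainOf T → X ⊆ Y ⊎ Y ⊆ X
  comparable X∈ Y∈ with ∈-chainOf⁻ T X∈ | ∈-chainOf⁻ T Y∈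
  ... | inj₂ refl | _ = inj₂ (⊆top Y∈)
  ... | inj₁ _ | inj₂ refl = inj₁ (⊆top X∈)
  ... | inj₁ (σ , σ∈ , star∈σ , refl) | inj₁ (ρ , ρ∈ , star∈ρ , refl)
    with compatible-star⇒nested star∈σ star∈ρ (tubing⇒compatible tubing σ∈ ρ∈)
  ...   | inj₁ σ⊆ρ = inj₁ (─-monoˡ-⊆ (outerPart-mono σ⊆ρ))
  ...   | inj₂ ρ⊆σ = inj₂ (─-monoˡ-⊆ (outerPart-mono ρ⊆σ))

outerPart─⊂⊤─ : ∀ {J} → IsTube σ → star ∈ σ → J ⊆ outerPart σ → outerPart σ ─ J ⊂ ⊤ ─ J
outerPart─⊂⊤─ {σ = _ ∷ σ} (_ , (_ , zero , _ , star∉σ) , _) here _ = ⊥-elim (star∉σ here)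
outerPart─⊂⊤─ {σ = _ ∷ σ} {J} (_ , (_ , suc i , _ , x∉σ) , _) _ J⊆σ =
  ─-monoˡ-⊆ ⊆⊤ , i , x∈p∧x∉q⇒x∈p─q ∈⊤ (x∉σ ∘ there ∘ J⊆σ) , x∉σ ∘ there ∘ p─q⊆p σ J

chainOf-reflects-starTube : IsTubing T → IsTube σ → star ∈ σ → singletonIdx T ⊆ outerPart σ →
  outerPart σ ─ singletonIdx T ∈ₗ chainOf T → σ ∈ₗ T
chainOf-reflects-starTube {T = T} {σ = σ} tubing σ-tube star∈σ I⊆σ σ∈ with ∈-chainOf⁻ T σ∈
... | inj₁ (ρ , ρ∈T , star∈ρ , eq) = subst (_∈ₗ T) ρ≡σ ρ∈T
  where
  ρ≡σ : ρ ≡ σ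
  ρ≡σ = star∈⇒≡ star∈ρ star∈σ
          (─-cancelʳ (singletonIdx⊆outerPart tubing ρ∈T star∈ρ) I⊆σ (sym eq))
... | inj₂ eq = ⊥-elim (⊂-irref eq (outerPart─⊂⊤─ σ-tube star∈σ I⊆σ))

singletonIdx-∷-star : star ∈ τ → singletonIdx (τ ∷ T) ≡ singletonIdx T
singletonIdx-∷-star {τ = τ} {T = T} star∈τ =
  ⊆-antisym ⊆I (∈-singletonIdx⁺ (τ ∷ T) ∘ there ∘ ∈-singletonIdx⁻ T)
  where
  ⊆I : singletonIdx (τ ∷ T) ⊆ singletonIdx T
  ⊆I i∈ with ∈-singletonIdx⁻ (τ ∷ T) i∈
  ... | here refl = ⊥-elim (star∉⁅outer⁆ star∈τ)
  ... | there ⁅i⁆∈T = ∈-singletonIdx⁺ T ⁅i⁆∈T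

singletonIdx-∷-⁅outer⁆ : singletonIdx (⁅ outer i ⁆ ∷ T) ≡ singletonIdx T ∪ ⁅ i ⁆
singletonIdx-∷-⁅outer⁆ {i = i} {T = T} = ⊆-antisym ⊆∪ ∪⊆
  where
  ⊆∪ : singletonIdx (⁅ outer i ⁆ ∷ T) ⊆ singletonIdx T ∪ ⁅ i ⁆
  ⊆∪ {j} j∈ with ∈-singletonIdx⁻ (⁅ outer i ⁆ ∷ T) j∈
  ... | there ⁅j⁆∈T = x∈p∪q⁺ (inj₁ (∈-singletonIdx⁺ T ⁅j⁆∈T))
  ... | here eq with ⁅outer⁆-injective eq
  ...   | refl = x∈p∪q⁺ (inj₂ (x∈⁅x⁆ _))
  ∪⊆ : singletonIdx T ∪ ⁅ i ⁆ ⊆ singletonIdx (⁅ outer i ⁆ ∷ T)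
  ∪⊆ j∈ with x∈p∪q⁻ (singletonIdx T) ⁅ i ⁆ j∈
  ... | inj₁ j∈I = ∈-singletonIdx⁺ (⁅ outer i ⁆ ∷ T) (there (∈-singletonIdx⁻ T j∈I))
  ... | inj₂ j∈⁅i⁆ with x∈⁅y⁆⇒x≡y i j∈⁅i⁆
  ...   | refl = ∈-singletonIdx⁺ (⁅ outer i ⁆ ∷ T) (here refl)

chainOf-∷-star : star ∈ τ → chainOf (τ ∷ T) ≡ (outerPart τ ─ singletonIdx T) ∷ chainOf T
chainOf-∷-star {τ = τ} {T = T} star∈τ = begin
  chainFrom (singletonIdx (τ ∷ T)) (starTubes (τ ∷ T))
    ≡⟨ cong (λ J → chainFrom J (starTubes (τ ∷ T))) (singletonIdx-∷-star {T = T} star∈τ) ⟩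
  chainFrom (singletonIdx T) (starTubes (τ ∷ T))
    ≡⟨ cong (chainFrom (singletonIdx T)) (filter-accept (star ∈?_) {xs = T} star∈τ) ⟩
  chainFrom (singletonIdx T) (τ ∷ starTubes T)
    ∎
  where open ≡-Reasoning

chainOf-∷-⁅outer⁆ : chainOf (⁅ outer i ⁆ ∷ T) ≡ map (_- i) (chainOf T)
chainOf-∷-⁅outer⁆ {i = i} {T = T} = begin
  chainFrom (singletonIdx (⁅ outer i ⁆ ∷ T)) (starTubes (⁅ outer i ⁆ ∷ T))
    ≡⟨ cong (λ J → chainFrom J (starTubes (⁅ outer i ⁆ ∷ T))) (singletonIdx-∷-⁅outer⁆ {T = T}) ⟩
  chainFrom (I ∪ ⁅ i ⁆) (starTubes (⁅ outer i ⁆ ∷ T))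
    ≡⟨ cong (chainFrom (I ∪ ⁅ i ⁆)) (filter-reject (star ∈?_) {xs = T} (star∉⁅outer⁆ {i = i})) ⟩
  map (λ σ → outerPart σ ─ (I ∪ ⁅ i ⁆)) L
    ≡⟨ map-cong (λ σ → sym (p─q─r≡p─q∪r (outerPart σ) I ⁅ i ⁆)) L ⟩
  map (λ σ → outerPart σ ─ I - i) L
    ≡⟨ map-∘ L ⟩
  map (_- i) (chainOf T)
    ∎
  where
  open ≡-Reasoning
  I : Subset _
  I = singletonIdx T
  L : List (Subset (suc _))
  L = starTubes T ++ ⊤ ∷ []

≈C-refl : C ≈C C
≈C-refl _ = ⇔-id _

≈C-sym : C ≈C D → D ≈C C
≈C-sym C≈D X = ⇔-sym (C≈D X)

≈C-trans : C ≈C D → D ≈C E → C ≈C E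
≈C-trans C≈D D≈E X = D≈E X ⇔-∘ C≈D X

≡⇒≈C : C ≡ D → C ≈C D
≡⇒≈C refl = ≈C-refl

∷-≈C-cong : C ≈C D → (p ∷ C) ≈C (p ∷ D)
∷-≈C-cong C≈D _ = ∷-cong refl (λ {X} → C≈D X)

map-≈C-cong : (f : Subset m → Subset m) → C ≈C D → map f C ≈C map f D
map-≈C-cong f C≈D _ = map-∼-cong (λ _ → refl) (λ {X} → C≈D X)

largest-unique : ∀ {M N} → IsLargest M C → IsLargest N D → C ≈C D → M ≡ N
largest-unique (M∈C , ⊆M) (N∈D , ⊆N) C≈D =
  ⊆-antisym (⊆N (Equivalence.to (C≈D _) M∈C)) (⊆M (Equivalence.from (C≈D _) N∈D))

-- Tubings are determined by their chains

chainOf-≈C⇒singletonIdx-≡ : chainOf U ≈C chainOf V → singletonIdx U ≡ singletonIdx V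
chainOf-≈C⇒singletonIdx-≡ {U = U} {V = V} U≈V =
  ⊤─-injective (largest-unique (chainOf-largest U) (chainOf-largest V) U≈V)

chainOf-injective : IsTubing U → IsTubing V → chainOf U ≈C chainOf V → U ⊆T V
chainOf-injective {U = U} {V = V} tU tV U≈V {σ} σ∈U
  with tube-star-or-singleton (tubing⇒tube tU σ∈U) | chainOf-≈C⇒singletonIdx-≡ {U = U} {V = V} U≈V
... | inj₁ star∈σ | I≡ = chainOf-reflects-starTube tV (tubing⇒tube tU σ∈U) star∈σ
  (subst (_⊆ outerPart σ) I≡ (singletonIdx⊆outerPart tU σ∈U star∈σ))
  (subst (λ J → outerPart σ ─ J ∈ₗ chainOf V) I≡ (Equivalence.to (U≈V _) (∈-chainOf⁺ U σ∈U star∈σ)))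
... | inj₂ (i , refl) | I≡ = ∈-singletonIdx⁻ V (subst (i ∈_) I≡ (∈-singletonIdx⁺ U σ∈U))

chainOf-cong : T ⊆T U → U ⊆T T → chainOf T ≈C chainOf U
chainOf-cong {T = T} {U = U} T⊆U U⊆T X = mk⇔ (⊆chain T⊆U I≡) (⊆chain U⊆T (sym I≡))
  where
  I≡ : singletonIdx T ≡ singletonIdx U
  I≡ = ⊆-antisym (∈-singletonIdx⁺ U ∘ T⊆U ∘ ∈-singletonIdx⁻ T)
                 (∈-singletonIdx⁺ T ∘ U⊆T ∘ ∈-singletonIdx⁻ U)
  ⊆chain : ∀ {T U} → T ⊆T U → singletonIdx T ≡ singletonIdx U → X ∈ₗ chainOf T → X ∈ₗ chainOf U
  ⊆chain {T} {U} T⊆U I≡ X∈ with ∈-chainOf⁻ T X∈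
  ... | inj₁ (σ , σ∈T , star∈σ , refl) =
    subst (λ J → outerPart σ ─ J ∈ₗ chainOf U) (sym I≡) (∈-chainOf⁺ U (T⊆U σ∈T) star∈σ)
  ... | inj₂ refl = subst (λ J → ⊤ ─ J ∈ₗ chainOf U) (sym I≡) (top∈chainOf U)

-- Adding a tube is a chain step

addNonMaximal-∷-star : IsTubing (τ ∷ T) → τ ∉ₗ T → star ∈ τ →
  AddNonMaximal (chainOf T) (chainOf (τ ∷ T))
addNonMaximal-∷-star {τ = τ} {T = T} tτT τ∉T star∈τ =
  outerPart τ ─ I , ⊤ ─ I , chainOf-largest T , outerPart─⊂⊤─ τ-tube star∈τ I⊆τ ,
  τ∉T ∘ chainOf-reflects-starTube (tubing-tail tτT) τ-tube star∈τ I⊆τ ,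
  subst IsChain chain-eq (chainOf-isChain tτT) , ≡⇒≈C chain-eq
  where
  I : Subset _
  I = singletonIdx T
  τ-tube : IsTube τ
  τ-tube = tubing⇒tube tτT (here refl)
  chain-eq : chainOf (τ ∷ T) ≡ (outerPart τ ─ I) ∷ chainOf T
  chain-eq = chainOf-∷-star {T = T} star∈τ
  I⊆τ : I ⊆ outerPart τ
  I⊆τ = subst (_⊆ outerPart τ) (singletonIdx-∷-star {T = T} star∈τ)
              (singletonIdx⊆outerPart tτT (here refl) star∈τ)

removeElement-∷-⁅outer⁆ : IsTubing (⁅ outer i ⁆ ∷ T) → ⁅ outer i ⁆ ∉ₗ T →
  RemoveElement (chainOf T) (chainOf (⁅ outer i ⁆ ∷ T))
removeElement-∷-⁅outer⁆ {i = i} {T = T} tτT τ∉T =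
  i , i∈all , ≡⇒≈C (chainOf-∷-⁅outer⁆ {T = T})
  where
  i∉I : i ∉ singletonIdx T
  i∉I = τ∉T ∘ ∈-singletonIdx⁻ T
  i∈all : ∀ {X} → X ∈ₗ chainOf T → i ∈ X
  i∈all X∈ with ∈-chainOf⁻ T X∈
  ... | inj₁ (σ , σ∈T , star∈σ , refl) = x∈p∧x∉q⇒x∈p─q (outer∈⇒∈outerPart
          (compatible-star⇒∋outer star∈σ (tubing⇒compatible tτT (here refl) (there σ∈T)))) i∉I
  ... | inj₂ refl = x∈p∧x∉q⇒x∈p─q ∈⊤ i∉I

chainStep-∷ : IsTubing (τ ∷ T) → τ ∉ₗ T → ChainStep (chainOf T) (chainOf (τ ∷ T))
chainStep-∷ tτT τ∉T with tube-star-or-singleton (tubing⇒tube tτT (here refl))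
... | inj₁ star∈τ = inj₁ (addNonMaximal-∷-star tτT τ∉T star∈τ)
... | inj₂ (_ , refl) = inj₂ (removeElement-∷-⁅outer⁆ tτT τ∉T)

-- Every chain step is realised by adding a tube

ChainOfExtension : List (Subset (suc m)) → List (Subset m) → Set
ChainOfExtension U D = ∃ λ τ → IsTubing (τ ∷ U) × D ≈C chainOf (τ ∷ U)

starTube-compatible : ∀ {S} → IsTubing U → (∀ {X} → X ∈ₗ chainOf U → S ⊆ X ⊎ X ⊆ S) →
  σ ∈ₗ U → Compatible (inside ∷ (S ∪ singletonIdx U)) σ
starTube-compatible {U = U} {σ = σ} {S} tU comparable σ∈U
  with tube-star-or-singleton (tubing⇒tube tU σ∈U)
... | inj₂ (j , refl) = inj₂ (inj₁ (⁅x⁆⊆ (there (x∈p∪q⁺ (inj₂ (∈-singletonIdx⁺ U σ∈U))))))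
... | inj₁ star∈σ with comparable (∈-chainOf⁺ U σ∈U star∈σ)
...   | inj₁ S⊆σ─I = inj₁ (inside∷-⊆ star∈σ S∪I⊆σ)
  where
  S∪I⊆σ : S ∪ singletonIdx U ⊆ outerPart σ
  S∪I⊆σ x∈ with x∈p∪q⁻ S (singletonIdx U) x∈
  ... | inj₁ x∈S = p─q⊆p (outerPart σ) (singletonIdx U) (S⊆σ─I x∈S)
  ... | inj₂ x∈I = singletonIdx⊆outerPart tU σ∈U star∈σ x∈I
...   | inj₂ σ─I⊆S = inj₂ (inj₁ (⊆-inside∷ σ⊆S∪I))
  where
  σ⊆S∪I : outerPart σ ⊆ S ∪ singletonIdx U
  σ⊆S∪I {x} x∈σ with x ∈? singletonIdx U
  ... | yes x∈I = x∈p∪q⁺ (inj₂ x∈I)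
  ... | no x∉I = x∈p∪q⁺ (inj₁ (σ─I⊆S (x∈p∧x∉q⇒x∈p─q x∈σ x∉I)))

⁅outer⁆-compatible-tubing : IsTubing U → (∀ {X} → X ∈ₗ chainOf U → i ∈ X) →
  σ ∈ₗ U → Compatible ⁅ outer i ⁆ σ
⁅outer⁆-compatible-tubing {U = U} {i = i} {σ = σ} tU i∈all σ∈U
  with tube-star-or-singleton (tubing⇒tube tU σ∈U)
... | inj₁ star∈σ = inj₁ (⁅x⁆⊆ (∈outerPart⇒outer∈
  (p─q⊆p (outerPart σ) (singletonIdx U) (i∈all (∈-chainOf⁺ U σ∈U star∈σ)))))
... | inj₂ (j , refl) = ⁅outer⁆-compatible i j

addNonMaximal⇒extension : IsTubing U → C ≈C chainOf U → AddNonMaximal C D → ChainOfExtension U D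
addNonMaximal⇒extension {U = U} tU C≈U
  (S , M , (M∈C , _) , (S⊆M , i , i∈M , i∉S) , S∉C , (_ , comparable) , D≈S∷C) =
  inside ∷ (S ∪ I) ,
  tubing-∷ tU τ∉U (inside∷-isTube i∉S∪I)
    (starTube-compatible tU (comparable (here refl) ∘ there ∘ Equivalence.from (C≈U _))) ,
  ≈C-trans D≈S∷C (≈C-trans (∷-≈C-cong C≈U) (≈C-sym (≡⇒≈C chain-eq)))
  where
  I : Subset _
  I = singletonIdx U
  M⊆ : M ⊆ ⊤ ─ I
  M⊆ = proj₂ (chainOf-largest U) (Equivalence.to (C≈U _) M∈C)
  S∪I─I≡S : (S ∪ I) ─ I ≡ S
  S∪I─I≡S = p∪q─q≡p (x∈p─q⇒x∉q ⊤ I ∘ M⊆ ∘ S⊆M)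
  chain-eq : chainOf ((inside ∷ (S ∪ I)) ∷ U) ≡ S ∷ chainOf U
  chain-eq = trans (chainOf-∷-star {T = U} here) (cong (_∷ chainOf U) S∪I─I≡S)
  τ∉U : inside ∷ (S ∪ I) ∉ₗ U
  τ∉U τ∈U = S∉C (Equivalence.from (C≈U _) (subst (_∈ₗ chainOf U) S∪I─I≡S (∈-chainOf⁺ U τ∈U here)))
  i∉S∪I : i ∉ S ∪ I
  i∉S∪I i∈ with x∈p∪q⁻ S I i∈
  ... | inj₁ i∈S = i∉S i∈S
  ... | inj₂ i∈I = x∈p─q⇒x∉q ⊤ I (M⊆ i∈M) i∈I

removeElement⇒extension : IsTubing U → C ≈C chainOf U → RemoveElement C D → ChainOfExtension U D
removeElement⇒extension {U = U} tU C≈U (i , i∈all , D≈) =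
  ⁅ outer i ⁆ ,
  tubing-∷ tU (i∉I ∘ ∈-singletonIdx⁺ U) (⁅outer⁆-isTube i) (⁅outer⁆-compatible-tubing tU i∈all′) ,
  ≈C-trans D≈ (≈C-trans (map-≈C-cong (_- i) C≈U) (≈C-sym (≡⇒≈C (chainOf-∷-⁅outer⁆ {T = U}))))
  where
  i∈all′ : ∀ {X} → X ∈ₗ chainOf U → i ∈ X
  i∈all′ = i∈all ∘ Equivalence.from (C≈U _)
  i∉I : i ∉ singletonIdx U
  i∉I = x∈p─q⇒x∉q ⊤ (singletonIdx U) (i∈all′ (top∈chainOf U))

chainStep⇒extension : IsTubing U → C ≈C chainOf U → ChainStep C D → ChainOfExtension U D
chainStep⇒extension tU C≈U (inj₁ add) = addNonMaximal⇒extension tU C≈U add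
chainStep⇒extension tU C≈U (inj₂ remove) = removeElement⇒extension tU C≈U remove

iterates⇒⊆T : ∀ {j} → Iterates j C E →
  IsTubing U → C ≈C chainOf U → IsTubing V → E ≈C chainOf V → U ⊆T V
iterates⇒⊆T (done C≈E) tU C≈U tV E≈V =
  chainOf-injective tU tV (≈C-trans (≈C-sym C≈U) (≈C-trans C≈E E≈V))
iterates⇒⊆T (more first rest) tU C≈U tV E≈V with chainStep⇒extension tU C≈U first
... | _ , tτU , D≈τU = iterates⇒⊆T rest tτU D≈τU tV E≈V ∘ there

module _ {a} {X : Set a} where

  ∈-─⁺ : ∀ {x y} {ys : List X} (x∈ys : x ∈ₗ ys) → y ∈ₗ ys → x ≢ y → y ∈ₗ (ys Any.─ x∈ys)
  ∈-─⁺ (here refl) (here refl) x≢y = ⊥-elim (x≢y refl)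
  ∈-─⁺ (here refl) (there y∈ys) _ = y∈ys
  ∈-─⁺ (there x∈ys) (here refl) _ = here refl
  ∈-─⁺ (there x∈ys) (there y∈ys) x≢y = there (∈-─⁺ x∈ys y∈ys x≢y)

  unique-⊆⇒length≤ : ∀ {xs ys : List X} → Unique xs → xs ⊆ₗ ys → length xs ≤ length ys
  unique-⊆⇒length≤ {[]} _ _ = z≤n
  unique-⊆⇒length≤ {x ∷ xs} {ys} (x∉xs ∷ unique) x∷xs⊆ys = begin
    suc (length xs)              ≤⟨ s≤s (unique-⊆⇒length≤ unique xs⊆ys─x) ⟩
    suc (length (ys Any.─ x∈ys)) ≡⟨ length-removeAt′ ys _ ⟨
    length ys                    ∎
    where
    open ≤-Reasoning
    x∈ys : x ∈ₗ ys
    x∈ys = x∷xs⊆ys (here refl)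
    xs⊆ys─x : xs ⊆ₗ (ys Any.─ x∈ys)
    xs⊆ys─x y∈xs = ∈-─⁺ x∈ys (x∷xs⊆ys (there y∈xs)) (All.lookup x∉xs y∈xs)

  unique-⊆-missing⇒length< : ∀ {x} {xs ys : List X} →
    Unique xs → xs ⊆ₗ ys → x ∈ₗ ys → x ∉ₗ xs → length xs < length ys
  unique-⊆-missing⇒length< {xs = xs} unique xs⊆ys x∈ys x∉xs =
    unique-⊆⇒length≤ (¬Any⇒All¬ xs x∉xs ∷ unique)
      λ { (here refl) → x∈ys ; (there y∈xs) → xs⊆ys y∈xs }

module _ {a} {X : Set a} (_≟_ : DecidableEquality X) where

  open DecMembership _≟_ using () renaming (_∈?_ to _∈ₗ?_)

  ⊆-or-missing : (xs ys : List X) → ys ⊆ₗ xs ⊎ ∃ λ y → y ∈ₗ ys × y ∉ₗ xs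
  ⊆-or-missing xs ys with any? (λ y → ¬? (y ∈ₗ? xs)) ys
  ... | yes missing = inj₂ (find missing)
  ... | no ¬missing = inj₁ λ {y} y∈ys → decidable-stable (y ∈ₗ? xs) (¬missing ∘ lose y∈ys)

⊆T⇒iterates : ∀ j {k} {T T' : List (Subset (suc m))} →
  IsKTubing k T → IsKTubing (k + j) T' → T ⊆T T' → Iterates j (chainOf T) (chainOf T')
⊆T⇒iterates j {T = T} {T'} (tT , refl) (tT' , |T'|≡) T⊆T'
  with ⊆-or-missing (≡-dec _≟ᵇ_) T T' | j
... | inj₁ T'⊆T | zero = done (chainOf-cong T⊆T' T'⊆T)
... | inj₁ T'⊆T | suc _ =
  ⊥-elim (m+1+n≰m (length T) (subst (_≤ length T) |T'|≡ (unique-⊆⇒length≤ (tubing⇒unique tT') T'⊆T)))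
... | inj₂ (τ , τ∈T' , τ∉T) | zero = ⊥-elim (<-irrefl (sym (trans |T'|≡ (+-identityʳ _)))
  (unique-⊆-missing⇒length< (tubing⇒unique tT) T⊆T' τ∈T' τ∉T))
... | inj₂ (τ , τ∈T' , τ∉T) | suc j′ =
  more (chainStep-∷ tτT τ∉T) (⊆T⇒iterates j′ (tτT , refl) (tT' , trans |T'|≡ (+-suc _ j′)) τ∷T⊆T')
  where
  τ∷T⊆T' : (τ ∷ T) ⊆T T'
  τ∷T⊆T' (here refl) = τ∈T'
  τ∷T⊆T' (there σ∈T) = T⊆T' σ∈T
  tτT : IsTubing (τ ∷ T)
  tτT = tubing-∷ tT τ∉T (tubing⇒tube tT' τ∈T') (tubing⇒compatible tT' τ∈T' ∘ T⊆T')

lemma5p20 : (m k j : ℕ) → 1 ≤ m → (T T' : List (Subset (suc m)))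
    → IsKTubing k T → IsKTubing (k + j) T'
    → (T ⊆T T') ⇔ Iterates j (chainOf T) (chainOf T')
lemma5p20 _ _ j _ _ _ kT@(tT , _) kT'@(tT' , _) =
  mk⇔ (⊆T⇒iterates j kT kT') (λ steps → iterates⇒⊆T steps tT ≈C-refl tT' ≈C-refl)
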